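{- Let $G$ and $H$ be graphs with no isolated vertices and let $K=G\vee H$. Then $K$ admits a barbell partition if and only if $G$ or $H$ admits a barbell partition $\{R,W_1,W_2\}$ with $|W_1|\ge 2$ and $|W_2|\ge 2$.
   Context: All graphs are finite and simple. $G\vee H$ (the join) is the disjoint union of $G$ and $H$ together with all edges between $V(G)$ and $V(H)$. A barbell partition of a graph $G$ is a partition of $V(G)$ into three disjoint sets $\{R,W_1,W_2\}$ with $W_1,W_2\neq\emptyset$ ($R$ may be empty), no edges between $W_1$ and $W_2$, and $|N_G(r)\cap W_i|\neq 1$ for all $r\in R$, $i\in\{1,2\}$. -}

module Defs where

open import Data.Nat using (ℕ; zero; suc; _+_; _≤_)
open import Data.Fin using (Fin; zero; suc; splitAt)
open import Data.Bool using (Bool; true; false; _∧_)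
open import Data.Sum using (_⊎_; inj₁; inj₂)
open import Data.Product using (Σ; ∃; _×_)
open import Relation.Binary.PropositionalEquality using (_≡_; _≢_)

record Graph : Set where
  constructor graph
  field
    size : ℕ
    adj  : Fin size → Fin size → Bool
open Graph public

IsSimple : Graph → Set
IsSimple G = (∀ u v → adj G u v ≡ adj G v u) × (∀ v → adj G v v ≡ false)

NoIsolated : Graph → Set
NoIsolated G = ∀ v → ∃ λ u → adj G v u ≡ true

count : ∀ {n} → (Fin n → Bool) → ℕ
count {zero}  P = 0
count {suc n} P with P zero
... | true  = suc (count (λ i → P (suc i)))
... | false = count (λ i → P (suc i))

-- Join G ∨ H on vertex set Fin (size G + size H): first the vertices of G, then those of H.
joinAdj : ∀ {m n} → (Fin m → Fin m → Bool) → (Fin n → Fin n → Bool)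
        → Fin (m + n) → Fin (m + n) → Bool
joinAdj {m} a b u v with splitAt m u | splitAt m v
... | inj₁ i | inj₁ j = a i j
... | inj₂ i | inj₂ j = b i j
... | inj₁ _ | inj₂ _ = true
... | inj₂ _ | inj₁ _ = true

_∨ᴳ_ : Graph → Graph → Graph
G ∨ᴳ H = graph (size G + size H) (joinAdj (adj G) (adj H))

data Part : Set where
  R W₁ W₂ : Part

isPart : Part → Part → Bool
isPart R  R  = true
isPart W₁ W₁ = true
isPart W₂ W₂ = true
isPart _  _  = false

nbrsIn : (G : Graph) → (Fin (size G) → Part) → Fin (size G) → Part → ℕ
nbrsIn G p r w = count (λ v → adj G r v ∧ isPart w (p v))

classSize : (G : Graph) → (Fin (size G) → Part) → Part → ℕ
classSize G p w = count (λ v → isPart w (p v))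

IsBarbell : (G : Graph) → (Fin (size G) → Part) → Set
IsBarbell G p =
  (∃ λ v → p v ≡ W₁) × (∃ λ v → p v ≡ W₂) ×
  (∀ u v → p u ≡ W₁ → p v ≡ W₂ → adj G u v ≡ false) ×
  (∀ r → p r ≡ R → nbrsIn G p r W₁ ≢ 1 × nbrsIn G p r W₂ ≢ 1)

HasBarbell : Graph → Set
HasBarbell G = Σ (Fin (size G) → Part) (IsBarbell G)

HasBigBarbell : Graph → Set
HasBigBarbell G = Σ (Fin (size G) → Part) λ p →
  IsBarbell G p × 2 ≤ classSize G p W₁ × 2 ≤ classSize G p W₂

{-# OPTIONS --safe #-}
-- Since every vertex of G is adjacent to every vertex of H in G ∨ H, the two nonempty
-- classes W₁, W₂ of a barbell partition of G ∨ H lie on one side, say in G, and then all of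
-- H lies in R; restricting to G gives a barbell partition of G.  Conversely, a barbell
-- partition of G is extended by putting H into R; a vertex of H then sees all of Wᵢ, which
-- is fine exactly when |Wᵢ| ≥ 2.  Finally, in a graph without isolated vertices every
-- class Wᵢ of a barbell partition has two elements: a vertex of Wᵢ has a neighbour, which
-- lies either in Wᵢ or in R, and in the latter case it has at least two neighbours in Wᵢ.
module Submission where

open import Defs
open import Data.Bool using (Bool; true; false; _∧_)
open import Data.Bool.Properties using (∧-zeroʳ)
open import Data.Fin using (Fin; zero; suc; splitAt; _↑ˡ_; _↑ʳ_)
open import Data.Fin.Properties using (splitAt-↑ˡ; splitAt-↑ʳ; join-splitAt)
open import Data.Nat using (zero; suc; _+_; _≤_; z≤n; s≤s)
open import Data.Nat.Properties using (≤-trans; ≤∧≢⇒<; m≤n⇒m≤1+n; +-comm; +-identityʳ)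
open import Data.Product using (∃; _×_; _,_; proj₁; proj₂)
open import Data.Sum using (_⊎_; inj₁; inj₂; [_,_]′; swap)
open import Function using (_∘_)
open import Function.Bundles using (_⇔_; mk⇔)
open import Relation.Binary.PropositionalEquality
  using (_≡_; _≢_; refl; sym; trans; cong; cong₂; subst; module ≡-Reasoning)
open import Relation.Nullary using (contradiction)

count-cong : ∀ {n} {P Q : Fin n → Bool} → (∀ i → P i ≡ Q i) → count P ≡ count Q
count-cong {zero}          P≗Q = refl
count-cong {suc n} {P} {Q} P≗Q with P zero | Q zero | P≗Q zero
... | true  | true  | _ = cong suc (count-cong (P≗Q ∘ suc))
... | false | false | _ = count-cong (P≗Q ∘ suc)

count-false : ∀ {n} (P : Fin n → Bool) → (∀ i → P i ≡ false) → count P ≡ 0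
count-false {zero}  P P≡false = refl
count-false {suc n} P P≡false with P zero | P≡false zero
... | false | _ = count-false (P ∘ suc) (P≡false ∘ suc)

count-+ : ∀ m {n} (P : Fin (m + n) → Bool) →
          count P ≡ count (λ i → P (i ↑ˡ n)) + count (λ j → P (m ↑ʳ j))
count-+ zero    P = refl
count-+ (suc m) P with P zero
... | true  = cong suc (count-+ m (P ∘ suc))
... | false = count-+ m (P ∘ suc)

count-mono : ∀ {n} {P Q : Fin n → Bool} → (∀ i → P i ≡ true → Q i ≡ true) → count P ≤ count Q
count-mono {zero}          P⇒Q = z≤n
count-mono {suc n} {P} {Q} P⇒Q with P zero in eP | Q zero in eQ
... | true  | true  = s≤s (count-mono (P⇒Q ∘ suc))
... | true  | false = contradiction (trans (sym (P⇒Q zero eP)) eQ) λ ()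
... | false | true  = m≤n⇒m≤1+n (count-mono (P⇒Q ∘ suc))
... | false | false = count-mono (P⇒Q ∘ suc)

1≤count : ∀ {n} (P : Fin n → Bool) i → P i ≡ true → 1 ≤ count P
1≤count P zero    Pi rewrite Pi = s≤s z≤n
1≤count P (suc i) Pi with P zero
... | true  = s≤s z≤n
... | false = 1≤count (P ∘ suc) i Pi

2≤count : ∀ {n} (P : Fin n → Bool) {i j} → i ≢ j → P i ≡ true → P j ≡ true → 2 ≤ count P
2≤count P {zero}  {zero}  i≢j Pi Pj = contradiction refl i≢j
2≤count P {zero}  {suc j} i≢j Pi Pj rewrite Pi = s≤s (1≤count (P ∘ suc) j Pj)
2≤count P {suc i} {zero}  i≢j Pi Pj rewrite Pj = s≤s (1≤count (P ∘ suc) i Pi)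
2≤count P {suc i} {suc j} i≢j Pi Pj with P zero
... | true  = s≤s (1≤count (P ∘ suc) i Pi)
... | false = 2≤count (P ∘ suc) (i≢j ∘ cong suc) Pi Pj

isPart-refl : ∀ w → isPart w w ≡ true
isPart-refl R  = refl
isPart-refl W₁ = refl
isPart-refl W₂ = refl

∧-elimʳ : ∀ a {b} → a ∧ b ≡ true → b ≡ true
∧-elimʳ true b≡true = b≡true

module _ {G : Graph} (simple : IsSimple G) (noIsolated : NoIsolated G)
         (p : Fin (size G) → Part) where

  barbell-class-≥2 : ∀ {w v} → p v ≡ w →
                     (∀ x → adj G v x ≡ true → p x ≡ w ⊎ p x ≡ R) →
                     (∀ r → p r ≡ R → nbrsIn G p r w ≢ 1) →
                     2 ≤ classSize G p w
  barbell-class-≥2 {w} {v} pv≡w closed R-ok with noIsolated v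
  ... | x , vx with closed x vx
  ... | inj₁ px≡w = 2≤count _ v≢x (inW pv≡w) (inW px≡w)
    where
    inW : ∀ {u} → p u ≡ w → isPart w (p u) ≡ true
    inW refl = isPart-refl w
    v≢x : v ≢ x
    v≢x refl = contradiction (trans (sym vx) (proj₂ simple v)) λ ()
  ... | inj₂ px≡R = ≤-trans (≤∧≢⇒< x-sees-v (R-ok x px≡R ∘ sym)) nbrs≤class
    where
    x-sees-v : 1 ≤ nbrsIn G p x w
    x-sees-v = 1≤count _ v (cong₂ _∧_ (trans (proj₁ simple x v) vx)
                                      (trans (cong (isPart w) pv≡w) (isPart-refl w)))
    nbrs≤class : nbrsIn G p x w ≤ classSize G p w
    nbrs≤class = count-mono (λ u → ∧-elimʳ (adj G x u))

  barbell-classes-≥2 : IsBarbell G p → 2 ≤ classSize G p W₁ × 2 ≤ classSize G p W₂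
  barbell-classes-≥2 ((v , pv) , (w , pw) , noEdge , R-ok) =
    barbell-class-≥2 pv closed₁ (λ r → proj₁ ∘ R-ok r) ,
    barbell-class-≥2 pw closed₂ (λ r → proj₂ ∘ R-ok r)
    where
    closed₁ : ∀ x → adj G v x ≡ true → p x ≡ W₁ ⊎ p x ≡ R
    closed₁ x vx with p x in px
    ... | R  = inj₂ refl
    ... | W₁ = inj₁ refl
    ... | W₂ = contradiction (trans (sym vx) (noEdge v x pv px)) λ ()
    closed₂ : ∀ x → adj G w x ≡ true → p x ≡ W₂ ⊎ p x ≡ R
    closed₂ x wx with p x in px
    ... | R  = inj₂ refl
    ... | W₁ = contradiction (trans (sym wx) (trans (proj₁ simple w x) (noEdge x w px pw))) λ ()
    ... | W₂ = inj₁ refl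

record JoinOf (A B K : Graph) : Set where
  field
    inl : Fin (size A) → Fin (size K)
    inr : Fin (size B) → Fin (size K)
    locate : Fin (size K) → Fin (size A) ⊎ Fin (size B)
    locate-inl : ∀ i → locate (inl i) ≡ inj₁ i
    locate-inr : ∀ j → locate (inr j) ≡ inj₂ j
    locate⁻¹ : ∀ u → [ inl , inr ]′ (locate u) ≡ u
    adj-inl : ∀ i i′ → adj K (inl i) (inl i′) ≡ adj A i i′
    adj-inr : ∀ j j′ → adj K (inr j) (inr j′) ≡ adj B j j′
    adj-inl-inr : ∀ i j → adj K (inl i) (inr j) ≡ true
    adj-inr-inl : ∀ j i → adj K (inr j) (inl i) ≡ true
    -- inl and inr together enumerate each vertex of K exactly once.
    count-split : ∀ P → count P ≡ count (P ∘ inl) + count (P ∘ inr)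

JoinOf-sym : ∀ {A B K} → JoinOf A B K → JoinOf B A K
JoinOf-sym J = record
  { inl = inr ; inr = inl
  ; locate = swap ∘ locate
  ; locate-inl = cong swap ∘ locate-inr
  ; locate-inr = cong swap ∘ locate-inl
  ; locate⁻¹ = λ u → trans (swap-elim (locate u)) (locate⁻¹ u)
  ; adj-inl = adj-inr ; adj-inr = adj-inl
  ; adj-inl-inr = adj-inr-inl ; adj-inr-inl = adj-inl-inr
  ; count-split = λ P → trans (count-split P) (+-comm (count (P ∘ inl)) _)
  }
  where
  open JoinOf J
  swap-elim : ∀ s → [ inr , inl ]′ (swap s) ≡ [ inl , inr ]′ s
  swap-elim (inj₁ _) = refl
  swap-elim (inj₂ _) = refl

∨ᴳ-JoinOf : ∀ G H → JoinOf G H (G ∨ᴳ H)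
∨ᴳ-JoinOf G H = record
  { inl = _↑ˡ n ; inr = m ↑ʳ_
  ; locate = splitAt m
  ; locate-inl = λ i → splitAt-↑ˡ m i n
  ; locate-inr = splitAt-↑ʳ m n
  ; locate⁻¹ = join-splitAt m n
  ; adj-inl = λ i i′ → trans (adjacency _ _) (cong₂ case (splitAt-↑ˡ m i n) (splitAt-↑ˡ m i′ n))
  ; adj-inr = λ j j′ → trans (adjacency _ _) (cong₂ case (splitAt-↑ʳ m n j) (splitAt-↑ʳ m n j′))
  ; adj-inl-inr = λ i j → trans (adjacency _ _) (cong₂ case (splitAt-↑ˡ m i n) (splitAt-↑ʳ m n j))
  ; adj-inr-inl = λ j i → trans (adjacency _ _) (cong₂ case (splitAt-↑ʳ m n j) (splitAt-↑ˡ m i n))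
  ; count-split = count-+ m
  }
  where
  m = size G
  n = size H
  case : Fin m ⊎ Fin n → Fin m ⊎ Fin n → Bool
  case (inj₁ i) (inj₁ j) = adj G i j
  case (inj₂ i) (inj₂ j) = adj H i j
  case (inj₁ _) (inj₂ _) = true
  case (inj₂ _) (inj₁ _) = true
  adjacency : ∀ u v → adj (G ∨ᴳ H) u v ≡ case (splitAt m u) (splitAt m v)
  adjacency u v with splitAt m u | splitAt m v
  ... | inj₁ _ | inj₁ _ = refl
  ... | inj₁ _ | inj₂ _ = refl
  ... | inj₂ _ | inj₁ _ = refl
  ... | inj₂ _ | inj₂ _ = refl

module _ {A B K : Graph} (J : JoinOf A B K) where
  open JoinOf J

  vertex-cases : ∀ u → (∃ λ i → u ≡ inl i) ⊎ (∃ λ j → u ≡ inr j)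
  vertex-cases u with locate u | locate⁻¹ u
  ... | inj₁ i | refl = inj₁ (i , refl)
  ... | inj₂ j | refl = inj₂ (j , refl)

  nbrsIn-inl : ∀ q w → isPart w R ≡ false → (∀ j → q (inr j) ≡ R) → ∀ u →
               nbrsIn K q u w ≡ count (λ i → adj K u (inl i) ∧ isPart w (q (inl i)))
  nbrsIn-inl q w w∉R outside-R u = begin
    nbrsIn K q u w              ≡⟨ count-split _ ⟩
    count seen + count seenInr  ≡⟨ cong (count seen +_) (count-false seenInr seenInr-false) ⟩
    count seen + 0              ≡⟨ +-identityʳ _ ⟩
    count seen                  ∎
    where
    open ≡-Reasoning
    seen : Fin (size A) → Bool
    seen i = adj K u (inl i) ∧ isPart w (q (inl i))
    seenInr : Fin (size B) → Bool
    seenInr j = adj K u (inr j) ∧ isPart w (q (inr j))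
    seenInr-false : ∀ j → seenInr j ≡ false
    seenInr-false j rewrite outside-R j | w∉R = ∧-zeroʳ _

  count-adj-inl : ∀ (P : Fin (size A) → Bool) r →
                  count (λ x → adj K (inl r) (inl x) ∧ P x) ≡ count (λ x → adj A r x ∧ P x)
  count-adj-inl P r = count-cong λ x → cong (_∧ P x) (adj-inl r x)

  module _ {q : Fin (size K) → Part} (barbell : IsBarbell K q) {i} (qi≡W₁ : q (inl i) ≡ W₁) where
    private
      noEdge = proj₁ (proj₂ (proj₂ barbell))
      R-ok = proj₂ (proj₂ (proj₂ barbell))

    W₂-inl : ∃ λ j → q (inl j) ≡ W₂
    W₂-inl with proj₁ (proj₂ barbell)
    ... | v , qv with vertex-cases v
    ...   | inj₁ (j , refl) = j , qv
    ...   | inj₂ (j , refl) = contradiction (trans (sym (adj-inl-inr i j)) (noEdge _ _ qi≡W₁ qv)) λ ()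

    inr-R : ∀ j → q (inr j) ≡ R
    inr-R j with q (inr j) in qj | W₂-inl
    ... | R  | _ = refl
    ... | W₁ | k , qk≡W₂ = contradiction (trans (sym (adj-inr-inl j k)) (noEdge _ _ qj qk≡W₂)) λ ()
    ... | W₂ | _         = contradiction (trans (sym (adj-inl-inr i j)) (noEdge _ _ qi≡W₁ qj)) λ ()

    restrict-barbell : IsBarbell A (q ∘ inl)
    restrict-barbell =
      (i , qi≡W₁) , W₂-inl ,
      (λ x y qx qy → trans (sym (adj-inl x y)) (noEdge _ _ qx qy)) ,
      (λ r qr → (proj₁ (R-ok (inl r) qr) ∘ trans (nbrsIn-restrict W₁ refl r)) ,
                (proj₂ (R-ok (inl r) qr) ∘ trans (nbrsIn-restrict W₂ refl r)))
      where
      nbrsIn-restrict : ∀ w → isPart w R ≡ false → ∀ r → nbrsIn K q (inl r) w ≡ nbrsIn A (q ∘ inl) r w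
      nbrsIn-restrict w w∉R r = trans (nbrsIn-inl q w w∉R inr-R (inl r)) (count-adj-inl _ r)

  extendByR : (Fin (size A) → Part) → Fin (size K) → Part
  extendByR p u = [ p , (λ _ → R) ]′ (locate u)

  module _ {p : Fin (size A) → Part} where
    extendByR-inl : ∀ i → extendByR p (inl i) ≡ p i
    extendByR-inl i = cong [ p , (λ _ → R) ]′ (locate-inl i)

    extendByR-inr : ∀ j → extendByR p (inr j) ≡ R
    extendByR-inr j = cong [ p , (λ _ → R) ]′ (locate-inr j)

    nbrsIn-extendByR : ∀ w → isPart w R ≡ false → ∀ u →
                       nbrsIn K (extendByR p) u w ≡ count (λ i → adj K u (inl i) ∧ isPart w (p i))
    nbrsIn-extendByR w w∉R u =
      trans (nbrsIn-inl (extendByR p) w w∉R extendByR-inr u)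
            (count-cong λ i → cong (λ x → adj K u (inl i) ∧ isPart w x) (extendByR-inl i))

    extendByR-R-ok : ∀ w → isPart w R ≡ false → (∀ r → p r ≡ R → nbrsIn A p r w ≢ 1) →
                     2 ≤ classSize A p w → ∀ u → extendByR p u ≡ R → nbrsIn K (extendByR p) u w ≢ 1
    extendByR-R-ok w w∉R R-ok big u qu rewrite nbrsIn-extendByR w w∉R u with vertex-cases u
    ... | inj₁ (r , refl) = R-ok r (trans (sym (extendByR-inl r)) qu)
                          ∘ trans (sym (count-adj-inl _ r))
    ... | inj₂ (j , refl) = λ seen≡1 → contradiction (subst (2 ≤_) (trans all-seen seen≡1) big) λ { (s≤s ()) }
      where
      all-seen : classSize A p w ≡ count (λ i → adj K (inr j) (inl i) ∧ isPart w (p i))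
      all-seen = count-cong λ i → cong (_∧ isPart w (p i)) (sym (adj-inr-inl j i))

    extend-barbell : IsBarbell A p → 2 ≤ classSize A p W₁ → 2 ≤ classSize A p W₂ →
                     IsBarbell K (extendByR p)
    extend-barbell ((v , pv) , (w , pw) , noEdge , R-ok) big₁ big₂ =
      (inl v , trans (extendByR-inl v) pv) ,
      (inl w , trans (extendByR-inl w) pw) ,
      noEdge′ ,
      (λ r qr → extendByR-R-ok W₁ refl (λ r → proj₁ ∘ R-ok r) big₁ r qr ,
                extendByR-R-ok W₂ refl (λ r → proj₂ ∘ R-ok r) big₂ r qr)
      where
      noEdge′ : ∀ x y → extendByR p x ≡ W₁ → extendByR p y ≡ W₂ → adj K x y ≡ false
      noEdge′ x y qx qy with vertex-cases x | vertex-cases y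
      ... | inj₁ (i , refl) | inj₁ (j , refl) =
        trans (adj-inl i j) (noEdge i j (trans (sym (extendByR-inl i)) qx) (trans (sym (extendByR-inl j)) qy))
      ... | inj₁ _ | inj₂ (j , refl) = contradiction (trans (sym (extendByR-inr j)) qy) λ ()
      ... | inj₂ (i , refl) | _      = contradiction (trans (sym (extendByR-inr i)) qx) λ ()

mainTheorem10 : (G H : Graph) → IsSimple G → IsSimple H →
    NoIsolated G → NoIsolated H →
    HasBarbell (G ∨ᴳ H) ⇔ (HasBigBarbell G ⊎ HasBigBarbell H)
mainTheorem10 G H simpleG simpleH noIsoG noIsoH = mk⇔ to from
  where
  J : JoinOf G H (G ∨ᴳ H)
  J = ∨ᴳ-JoinOf G H
  to : HasBarbell (G ∨ᴳ H) → HasBigBarbell G ⊎ HasBigBarbell H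
  to (q , barbell@((v , qv) , _)) with vertex-cases J v
  ... | inj₁ (i , refl) = let b = restrict-barbell J barbell qv in
    inj₁ (_ , b , barbell-classes-≥2 simpleG noIsoG _ b)
  ... | inj₂ (j , refl) = let b = restrict-barbell (JoinOf-sym J) barbell qv in
    inj₂ (_ , b , barbell-classes-≥2 simpleH noIsoH _ b)
  from : HasBigBarbell G ⊎ HasBigBarbell H → HasBarbell (G ∨ᴳ H)
  from (inj₁ (_ , b , big₁ , big₂)) = _ , extend-barbell J b big₁ big₂
  from (inj₂ (_ , b , big₁ , big₂)) = _ , extend-barbell (JoinOf-sym J) b big₁ big₂
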